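{- For every $n\ge1$, the map $\eta$ defined below is a bijection of $\mathrm{And}_n^{I}$ onto $\mathrm{Alt}_n$, and $\mathbf{F}\,w=\mathbf{F}\,\eta(w)$ for every $w\in\mathrm{And}_n^{I}$.
   Context: Words $w=x_1\cdots x_n$ are permutations of finite sets $Y$ of positive integers; $C(w)=Y$, $|w|=n$, $e$ the empty word. Andr\'e I permutations: $e$ and one-letter words are Andr\'e I; for $|Y|\ge2$ write $w=v\,\min(w)\,v'$; $w$ is Andr\'e I if $v,v'$ are Andr\'e I and $\max(vv')$ is a letter of $v'$. $\mathrm{And}_n^{I}$: Andr\'e I permutations of $\{1,\dots,n\}$. $\mathrm{Alt}_n$: permutations $x_1\cdots x_n$ of $\{1,\dots,n\}$ with $x_1<x_2>x_3<x_4>\cdots$. $\mathbf{F}\,w=x_1$. Reduction: for a permutation $u$ of $Y$ with $|Y|=l$, $\rho(u)=\rho_Y(u)$ is obtained by replacing each letter by its rank in $Y$ (a permutation of $\{1,\dots,l\}$), and $\rho_Y^{ -1}$ is the inverse relabeling of $\{1,\dots,l\}$ onto $Y$. For a permutation $u=u_1\cdots u_l$ of $\{1,\dots,l\}$, $\mathbf{c}(u)=(l+1-u_1)\cdots(l+1-u_l)$. Definition of $\eta$ (recursive): $\eta(1)=1$, $\eta(12)=12$, $\eta(123)=132$, $\eta(213)=231$. For $n\ge4$ and $w\in\mathrm{And}_n^{I}$ write $w=w'\,1\,w''$. If $w'=e$, put $v'=1$ and $v''=\rho_{C(w'')}^{ -1}\,\mathbf{c}\,\eta\,\rho(w'')$.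 If $w'\ne e$, put $v'=\rho_{C(w')}^{ -1}\,\eta\,\rho(w')$ and $v''=\rho_{C(1w'')}^{ -1}\,\eta\,\rho(1\,w'')$ if $|w'|$ is even, $v''=\rho_{C(1w'')}^{ -1}\,\mathbf{c}\,\eta\,\rho(1\,w'')$ if $|w'|$ is odd. Then $\eta(w)=v'v''$. -}

module Defs where

open import Data.Nat using (ℕ; zero; suc; _+_; _∸_; _≤_; _<_; _>_; _≟_; _≤?_; _≤ᵇ_)
open import Data.Bool using (Bool; true; false; if_then_else_)
open import Data.List using (List; []; _∷_; _++_; map; length; upTo; filter; head)
open import Data.List.Relation.Unary.All using (All)
open import Data.List.Membership.Propositional using (_∈_)
open import Data.List.Relation.Binary.Permutation.Propositional using (_↭_)
open import Data.Product using (Σ; _×_; _,_; ∃-syntax)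
open import Data.Unit using (⊤)
open import Relation.Binary.PropositionalEquality using (_≡_)
open import Relation.Nullary using (yes; no)

IsPerm : ℕ → List ℕ → Set
IsPerm n w = w ↭ map suc (upTo n)

-- André I permutations (inductive reading of the recursive definition):
-- w = v · m · v' with m = min(w) (all other letters > m), v and v' André I,
-- and max(v v') a letter of v'.
data AndreI : List ℕ → Set where
  andre-e   : AndreI []
  andre-one : (x : ℕ) → AndreI (x ∷ [])
  andre-split : (v : List ℕ) (m : ℕ) (v' : List ℕ) →
    All (m <_) (v ++ v') →
    AndreI v → AndreI v' →
    (∃[ x ] (x ∈ v' × All (_≤ x) (v ++ v'))) →
    AndreI (v ++ m ∷ v')

AndI : ℕ → List ℕ → Set
AndI n w = IsPerm n w × AndreI w

Up Down : List ℕ → Set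
Up (x ∷ y ∷ r) = x < y × Down (y ∷ r)
Up _ = ⊤
Down (x ∷ y ∷ r) = x > y × Up (y ∷ r)
Down _ = ⊤

Alt : ℕ → List ℕ → Set
Alt n w = IsPerm n w × Up w

rank : List ℕ → ℕ → ℕ
rank Y x = length (filter (λ y → y ≤? x) Y)

ρ : List ℕ → List ℕ
ρ u = map (rank u) u

-- the k-th smallest letter of Y (k ≥ 1): the letter y of Y with rank k; 0 if none
unrankIn : List ℕ → List ℕ → ℕ → ℕ
unrankIn Y [] k = 0
unrankIn Y (y ∷ Z) k with rank Y y ≟ k
... | yes _ = y
... | no _ = unrankIn Y Z k

unrank : List ℕ → ℕ → ℕ
unrank Y = unrankIn Y Y

ρinv : List ℕ → List ℕ → List ℕ
ρinv Y u = map (unrank Y) u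

comp : List ℕ → List ℕ
comp u = map (λ x → suc (length u) ∸ x) u

isEven : ℕ → Bool
isEven zero = true
isEven (suc zero) = false
isEven (suc (suc n)) = isEven n

splitAt1 : List ℕ → List ℕ × List ℕ
splitAt1 [] = [] , []
splitAt1 (x ∷ w) with x ≟ 1
... | yes _ = [] , w
... | no _ with splitAt1 w
...   | (a , b) = x ∷ a , b

-- η with a fuel parameter (fuel ≥ length suffices: every recursive call
-- is on a strictly shorter word).
ηf : ℕ → List ℕ → List ℕ
ηf zero w = w
ηf (suc f) (1 ∷ []) = 1 ∷ []
ηf (suc f) (1 ∷ 2 ∷ []) = 1 ∷ 2 ∷ []
ηf (suc f) (1 ∷ 2 ∷ 3 ∷ []) = 1 ∷ 3 ∷ 2 ∷ []
ηf (suc f) (2 ∷ 1 ∷ 3 ∷ []) = 2 ∷ 3 ∷ 1 ∷ []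
ηf (suc f) w with splitAt1 w
... | ([] , w'') = 1 ∷ ρinv w'' (comp (ηf f (ρ w'')))
... | (w'@(_ ∷ _) , w'') =
  ρinv w' (ηf f (ρ w')) ++
  ρinv (1 ∷ w'') (if isEven (length w')
                   then ηf f (ρ (1 ∷ w''))
                   else comp (ηf f (ρ (1 ∷ w''))))

η : List ℕ → List ℕ
η w = ηf (length w) w

F : List ℕ → _
F = head

-- For n ≥ 2 write w = w′ 1 w″; the André I condition puts n in w″. By induction,
-- η(w′) is an alternating arrangement of w′ with the same first letter, and the relabelled
-- η(1w″), complemented when |w′| is odd, is an alternating arrangement of 1w″ starting with 1 when
-- |w′| is even and with n when |w′| is odd (for w′ = e, η(w) = 1 · c η(w″) plays this role).
-- As w′ contains neither 1 nor n, that letter can follow the last letter of η(w′), so η(w)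
-- alternates, and its first letter in {1, n} sits at position |w′| + 1. Cutting η(w) there
-- recovers both factors, which gives injectivity; cutting an arbitrary alternating word before
-- its first letter in {1, n} and inverting η on both parts gives surjectivity.

module Submission where

open import Defs
open import Data.Bool using (Bool; true; false; not; if_then_else_)
open import Data.Empty using (⊥; ⊥-elim)
open import Data.List using (List; []; _∷_; _++_; map; length; upTo)
open import Data.List.Properties
  using (length-++; length-map; length-upTo; length-filter; map-∘; map-++; map-id-local; map-cong-local;
         filter-accept; filter-reject; filter-all; filter-none; ∷-injective; ∷-injectiveʳ; ++-cancelˡ)
open import Data.List.Membership.Propositional using (_∈_; _∉_)
open import Data.List.Membership.Propositional.Properties
  using (∈-map⁺; ∈-map⁻; ∈-++⁺ˡ; ∈-++⁺ʳ; ∈-++⁻; ∈-∃++; ∈-upTo⁺; ∈-upTo⁻)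
open import Data.List.Membership.Propositional.Properties.WithK using (unique∧set⇒bag)
open import Data.List.Relation.Binary.BagAndSetEquality using (∼bag⇒↭)
open import Data.List.Relation.Binary.Subset.Propositional using (_⊆_)
open import Data.List.Relation.Binary.Sublist.Propositional using (⊆-refl)
open import Data.List.Relation.Binary.Sublist.Propositional.Properties using (filter⁺; length-mono-≤)
open import Data.List.Relation.Binary.Permutation.Propositional
  using (_↭_; ↭-refl; ↭-sym; ↭-trans; prep; ↭⇒↭ₛ)
open import Data.List.Relation.Binary.Permutation.Propositional.Properties
  using (∈-resp-↭; ↭-length; ↭-singleton-inv; filter-↭; ++⁺; drop-∷)
import Data.List.Relation.Binary.Permutation.Setoid.Properties as Perm
open import Data.List.Relation.Unary.All as All using (All; []; _∷_)
open import Data.List.Relation.Unary.All.Properties using () renaming (map⁺ to All-map⁺)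
open import Data.List.Relation.Unary.AllPairs using ([]; _∷_)
open import Data.List.Relation.Unary.Any as Any using (here; there)
open import Data.List.Relation.Unary.Any.Properties using (¬Any[])
open import Data.List.Relation.Unary.Unique.Propositional using (Unique)
import Data.List.Relation.Unary.Unique.Propositional.Properties as Unique
open import Data.Maybe using (just)
open import Data.Maybe.Properties using (just-injective)
open import Data.Nat
open import Data.Nat.Induction using (<-rec)
open import Data.Nat.Properties
open import Data.List.Membership.DecPropositional _≟_ using (_∈?_)
open import Data.Product using (_×_; _,_; proj₁; proj₂; ∃-syntax)
open import Data.Sum using (_⊎_; inj₁; inj₂; [_,_]′)
open import Function using (_∘_)
open import Function.Bundles using (mk⇔)
open import Relation.Binary using (tri<; tri≈; tri>)
open import Relation.Binary.PropositionalEquality hiding ([_])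
open import Relation.Nullary using (¬_; yes; no)
open import Relation.Nullary.Decidable using (_⊎-dec_)
open import Relation.Unary using (Decidable)

-- Duplicate-free lists and permutations of {1,…,n}

Unique-resp-↭ : ∀ {xs ys : List ℕ} → xs ↭ ys → Unique xs → Unique ys
Unique-resp-↭ p = Perm.Unique-resp-↭ (setoid ℕ) (↭⇒↭ₛ p)

Unique-++⁻ˡ : ∀ (xs : List ℕ) {ys} → Unique (xs ++ ys) → Unique xs
Unique-++⁻ˡ []       _         = []
Unique-++⁻ˡ (x ∷ xs) (x∉ ∷ u) = All.tabulate (All.lookup x∉ ∘ ∈-++⁺ˡ) ∷ Unique-++⁻ˡ xs u

Unique-++⁻ʳ : ∀ (xs : List ℕ) {ys} → Unique (xs ++ ys) → Unique ys
Unique-++⁻ʳ []       u       = u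
Unique-++⁻ʳ (x ∷ xs) (_ ∷ u) = Unique-++⁻ʳ xs u

Unique-++-disjoint : ∀ (xs : List ℕ) {ys x} → Unique (xs ++ ys) → x ∈ xs → x ∉ ys
Unique-++-disjoint (y ∷ xs) (y∉ ∷ _) (here refl) x∈ys = All.lookup y∉ (∈-++⁺ʳ xs x∈ys) refl
Unique-++-disjoint (y ∷ xs) (_ ∷ u)  (there x∈xs) = Unique-++-disjoint xs u x∈xs

Unique-∷-least : ∀ {x} {Z : List ℕ} → Unique (x ∷ Z) → (∀ {y} → y ∈ Z → x ≤ y) → All (x <_) Z
Unique-∷-least u x≤ = All.tabulate λ y∈ → ≤∧≢⇒< (x≤ y∈) (λ { refl → Unique.Unique[x∷xs]⇒x∉xs u y∈ })

Unique-map⁺ : ∀ (f : ℕ → ℕ) {xs : List ℕ} → (∀ {x y} → x ∈ xs → y ∈ xs → f x ≡ f y → x ≡ y) →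
  Unique xs → Unique (map f xs)
Unique-map⁺ f {[]}     _   []        = []
Unique-map⁺ f {x ∷ xs} inj (x∉ ∷ u) =
  All.tabulate (λ fy∈ fx≡fy → let y , y∈ , fy≡ = ∈-map⁻ f fy∈ in
    All.lookup x∉ y∈ (inj (here refl) (there y∈) (trans fx≡fy fy≡)))
  ∷ Unique-map⁺ f (λ x∈ y∈ → inj (there x∈) (there y∈)) u

Unique∧⊆⇒↭ : ∀ {xs ys : List ℕ} → Unique xs → Unique ys → xs ⊆ ys → ys ⊆ xs → xs ↭ ys
Unique∧⊆⇒↭ u v sub sup = ∼bag⇒↭ (unique∧set⇒bag u v (mk⇔ sub sup))

length-++-∷ : ∀ (xs ys : List ℕ) {x} → length (xs ++ x ∷ ys) ≡ suc (length (xs ++ ys))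
length-++-∷ []       ys = refl
length-++-∷ (_ ∷ xs) ys = cong suc (length-++-∷ xs ys)

⊆-++-∷⁻ : ∀ {xs : List ℕ} (ys zs : List ℕ) {x} → x ∉ xs → xs ⊆ ys ++ x ∷ zs → xs ⊆ ys ++ zs
⊆-++-∷⁻ ys zs x∉ sub z∈ with ∈-++⁻ ys (sub z∈)
... | inj₁ z∈ys          = ∈-++⁺ˡ z∈ys
... | inj₂ (here refl)   = ⊥-elim (x∉ z∈)
... | inj₂ (there z∈zs)  = ∈-++⁺ʳ ys z∈zs

Unique∧⊆⇒length≤ : ∀ {xs ys : List ℕ} → Unique xs → xs ⊆ ys → length xs ≤ length ys
Unique∧⊆⇒length≤ {[]}     _          _   = z≤n
Unique∧⊆⇒length≤ {x ∷ xs} (x∉ ∷ u) sub with ∈-∃++ (sub (here refl))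
... | ys , zs , refl = subst (suc (length xs) ≤_) (sym (length-++-∷ ys zs))
  (s≤s (Unique∧⊆⇒length≤ u (⊆-++-∷⁻ ys zs (λ x∈ → All.lookup x∉ x∈ refl) (sub ∘ there))))

Unique∧⊆∧length≤⇒↭ : ∀ {xs ys : List ℕ} → Unique xs → Unique ys → xs ⊆ ys →
  length ys ≤ length xs → xs ↭ ys
Unique∧⊆∧length≤⇒↭ {xs} {ys} u v sub len = Unique∧⊆⇒↭ u v sub sup
  where
  sup : ys ⊆ xs
  sup {z} z∈ys with z ∈? xs
  ... | yes z∈xs = z∈xs
  ... | no z∉xs with ∈-∃++ z∈ys
  ...   | ys₁ , ys₂ , refl = ⊥-elim (<⇒≱ (begin-strict
    length xs               ≤⟨ Unique∧⊆⇒length≤ u (⊆-++-∷⁻ ys₁ ys₂ z∉xs sub) ⟩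
    length (ys₁ ++ ys₂)     <⟨ n<1+n _ ⟩
    suc (length (ys₁ ++ ys₂)) ≡⟨ length-++-∷ ys₁ ys₂ ⟨
    length (ys₁ ++ z ∷ ys₂) ∎) len)
    where open ≤-Reasoning

++⊆++-∷ : ∀ (xs ys : List ℕ) {x} → xs ++ ys ⊆ xs ++ x ∷ ys
++⊆++-∷ xs ys y∈ with ∈-++⁻ xs y∈
... | inj₁ y∈xs = ∈-++⁺ˡ y∈xs
... | inj₂ y∈ys = ∈-++⁺ʳ xs (there y∈ys)

∈-++-∷⁻ : ∀ {z} (v : List ℕ) {m v'} → z ∈ v ++ m ∷ v' → z ≡ m ⊎ z ∈ v ++ v'
∈-++-∷⁻ []      (here z≡m)  = inj₁ z≡m
∈-++-∷⁻ []      (there z∈)  = inj₂ z∈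
∈-++-∷⁻ (_ ∷ v) (here refl) = inj₂ (here refl)
∈-++-∷⁻ (_ ∷ v) (there z∈) with ∈-++-∷⁻ v z∈
... | inj₁ z≡m  = inj₁ z≡m
... | inj₂ z∈′  = inj₂ (there z∈′)

prefix-before-first-≡ : ∀ {P : ℕ → Set} (A₁ A₂ : List ℕ) {c₁ c₂ B₁ B₂} →
  All (¬_ ∘ P) A₁ → All (¬_ ∘ P) A₂ → P c₁ → P c₂ → A₁ ++ c₁ ∷ B₁ ≡ A₂ ++ c₂ ∷ B₂ → A₁ ≡ A₂
prefix-before-first-≡ []       []       _          _          _   _   _    = refl
prefix-before-first-≡ []       (_ ∷ _)  _          (¬P₂ ∷ _)  Pc₁ _   refl = ⊥-elim (¬P₂ Pc₁)
prefix-before-first-≡ (_ ∷ _)  []       (¬P₁ ∷ _)  _          _   Pc₂ refl = ⊥-elim (¬P₁ Pc₂)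
prefix-before-first-≡ (x ∷ A₁) (_ ∷ A₂) (_ ∷ ¬P₁) (_ ∷ ¬P₂) Pc₁ Pc₂ eq with refl , eq′ ← ∷-injective eq =
  cong (x ∷_) (prefix-before-first-≡ A₁ A₂ ¬P₁ ¬P₂ Pc₁ Pc₂ eq′)

first-occurrence : ∀ {P : ℕ → Set} → Decidable P → ∀ (u : List ℕ) {y} → y ∈ u → P y →
  ∃[ A ] ∃[ c ] ∃[ B ] (u ≡ A ++ c ∷ B × All (¬_ ∘ P) A × P c)
first-occurrence P? (x ∷ u) y∈ Py with P? x
... | yes Px = [] , x , u , refl , [] , Px
... | no ¬Px with y∈
...   | here refl = ⊥-elim (¬Px Py)
...   | there y∈u = let A , c , B , u≡ , ¬PA , Pc = first-occurrence P? u y∈u Py in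
                    x ∷ A , c , B , cong (x ∷_) u≡ , ¬Px ∷ ¬PA , Pc

InRange : ℕ → ℕ → Set
InRange n x = 1 ≤ x × x ≤ n

∈-range⁺ : ∀ {n x} → InRange n x → x ∈ map suc (upTo n)
∈-range⁺ {x = suc x} (_ , x<n) = ∈-map⁺ suc (∈-upTo⁺ x<n)

∈-range⁻ : ∀ {n x} → x ∈ map suc (upTo n) → InRange n x
∈-range⁻ x∈ with _ , i∈ , refl ← ∈-map⁻ suc x∈ = s≤s z≤n , ∈-upTo⁻ i∈

IsPerm-unique : ∀ {n w} → IsPerm n w → Unique w
IsPerm-unique {n} p = Unique-resp-↭ (↭-sym p) (Unique.map⁺ suc-injective (Unique.upTo⁺ n))

IsPerm-inRange : ∀ {n w x} → IsPerm n w → x ∈ w → InRange n x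
IsPerm-inRange p x∈ = ∈-range⁻ (∈-resp-↭ p x∈)

IsPerm-∋ : ∀ {n w x} → IsPerm n w → InRange n x → x ∈ w
IsPerm-∋ p x∈ = ∈-resp-↭ (↭-sym p) (∈-range⁺ x∈)

IsPerm-length : ∀ {n w} → IsPerm n w → length w ≡ n
IsPerm-length {n} p = trans (↭-length p) (trans (length-map suc (upTo n)) (length-upTo n))

IsPerm-intro : ∀ {n w} → Unique w → (∀ {x} → x ∈ w → InRange n x) → length w ≡ n → IsPerm n w
IsPerm-intro {n} u inRange len = Unique∧⊆∧length≤⇒↭ u (IsPerm-unique {n} ↭-refl)
  (∈-range⁺ ∘ inRange) (≤-reflexive (trans (IsPerm-length {n} ↭-refl) (sym len)))

-- Ranks, reductions and complements

rank-∷-≤ : ∀ {y x} (Y : List ℕ) → y ≤ x → rank (y ∷ Y) x ≡ suc (rank Y x)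
rank-∷-≤ {x = x} Y y≤x = cong length (filter-accept (_≤? x) {xs = Y} y≤x)

rank-∷-≰ : ∀ {y x} (Y : List ℕ) → ¬ y ≤ x → rank (y ∷ Y) x ≡ rank Y x
rank-∷-≰ {x = x} Y y≰x = cong length (filter-reject (_≤? x) {xs = Y} y≰x)

rank-mono-≤ : ∀ (Y : List ℕ) {x x'} → x ≤ x' → rank Y x ≤ rank Y x'
rank-mono-≤ Y {x} {x'} x≤x' =
  length-mono-≤ (filter⁺ (_≤? x) (_≤? x') (λ { refl y≤x → ≤-trans y≤x x≤x' }) (⊆-refl {x = Y}))

rank-mono-< : ∀ (Y : List ℕ) {x x'} → x < x' → x' ∈ Y → rank Y x < rank Y x'
rank-mono-< (y ∷ Y) x<y (here refl) =
  subst₂ _<_ (sym (rank-∷-≰ Y (<⇒≱ x<y))) (sym (rank-∷-≤ {y} Y ≤-refl)) (s≤s (rank-mono-≤ Y (<⇒≤ x<y)))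
rank-mono-< (y ∷ Y) {x} {x'} x<x' (there x'∈Y) with y ≤? x | y ≤? x'
... | yes y≤x | yes y≤x' =
  subst₂ _<_ (sym (rank-∷-≤ Y y≤x)) (sym (rank-∷-≤ Y y≤x')) (s≤s (rank-mono-< Y x<x' x'∈Y))
... | yes y≤x | no y≰x'  = ⊥-elim (y≰x' (≤-trans y≤x (<⇒≤ x<x')))
... | no y≰x  | yes y≤x' =
  subst₂ _<_ (sym (rank-∷-≰ Y y≰x)) (sym (rank-∷-≤ Y y≤x')) (m≤n⇒m≤1+n (rank-mono-< Y x<x' x'∈Y))
... | no y≰x  | no y≰x'  =
  subst₂ _<_ (sym (rank-∷-≰ Y y≰x)) (sym (rank-∷-≰ Y y≰x')) (rank-mono-< Y x<x' x'∈Y)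

rank-cancel-< : ∀ (Y : List ℕ) {x x'} → rank Y x < rank Y x' → x < x'
rank-cancel-< Y {x} {x'} r< with <-cmp x x'
... | tri< x<x' _ _ = x<x'
... | tri≈ _ refl _ = ⊥-elim (<-irrefl refl r<)
... | tri> _ _ x'<x = ⊥-elim (<⇒≱ r< (rank-mono-≤ Y (<⇒≤ x'<x)))

rank-injective : ∀ (Y : List ℕ) {x x'} → x ∈ Y → x' ∈ Y → rank Y x ≡ rank Y x' → x ≡ x'
rank-injective Y {x} {x'} x∈ x'∈ r≡ with <-cmp x x'
... | tri< x<x' _ _ = ⊥-elim (<-irrefl r≡ (rank-mono-< Y x<x' x'∈))
... | tri≈ _ x≡x' _ = x≡x'
... | tri> _ _ x'<x = ⊥-elim (<-irrefl (sym r≡) (rank-mono-< Y x'<x x∈))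

rank-inRange : ∀ (Y : List ℕ) {x} → x ∈ Y → InRange (length Y) (rank Y x)
rank-inRange Y {x} x∈ = positive Y x∈ , length-filter (_≤? x) Y
  where
  positive : ∀ Y → x ∈ Y → 1 ≤ rank Y x
  positive (y ∷ Y) (here refl) = subst (1 ≤_) (sym (rank-∷-≤ {y} Y ≤-refl)) (s≤s z≤n)
  positive (y ∷ Y) (there x∈Y) with y ≤? x
  ... | yes y≤x = subst (1 ≤_) (sym (rank-∷-≤ Y y≤x)) (s≤s z≤n)
  ... | no y≰x  = subst (1 ≤_) (sym (rank-∷-≰ Y y≰x)) (positive Y x∈Y)

rank-resp-↭ : ∀ {Y Z : List ℕ} → Y ↭ Z → ∀ x → rank Y x ≡ rank Z x
rank-resp-↭ p x = ↭-length (filter-↭ (_≤? x) p)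

rank-of-upperBound : ∀ (Y : List ℕ) {x} → All (_≤ x) Y → rank Y x ≡ length Y
rank-of-upperBound Y {x} Y≤x = cong length (filter-all (_≤? x) Y≤x)

rank-of-strictLowerBound : ∀ (Y : List ℕ) {x} → All (x <_) Y → rank Y x ≡ 0
rank-of-strictLowerBound Y {x} x<Y = cong length (filter-none (_≤? x) (All.map <⇒≱ x<Y))

unrankIn-correct : ∀ (Y Z : List ℕ) {y k} → y ∈ Z → rank Y y ≡ k →
  unrankIn Y Z k ∈ Z × rank Y (unrankIn Y Z k) ≡ k
unrankIn-correct Y (z ∷ Z) {k = k} y∈ r≡ with rank Y z ≟ k
... | yes rz≡k = here refl , rz≡k
... | no rz≢k with y∈
...   | here refl  = ⊥-elim (rz≢k r≡)
...   | there y∈Z = let u∈ , ru≡ = unrankIn-correct Y Z y∈Z r≡ in there u∈ , ru≡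

unrank-rank : ∀ (Y : List ℕ) {y} → y ∈ Y → unrank Y (rank Y y) ≡ y
unrank-rank Y y∈ = let u∈ , ru≡ = unrankIn-correct Y Y y∈ refl in rank-injective Y u∈ y∈ ru≡

ρ-isPerm : ∀ {w : List ℕ} → Unique w → IsPerm (length w) (ρ w)
ρ-isPerm {w} u = IsPerm-intro
  (Unique-map⁺ (rank w) (rank-injective w) u)
  (λ r∈ → let x , x∈ , r≡ = ∈-map⁻ (rank w) r∈ in subst (InRange (length w)) (sym r≡) (rank-inRange w x∈))
  (length-map (rank w) w)

rank-surjective : ∀ {Y : List ℕ} → Unique Y → ∀ {k} → InRange (length Y) k →
  ∃[ y ] (y ∈ Y × rank Y y ≡ k)
rank-surjective {Y} u k∈ =
  let y , y∈ , k≡ = ∈-map⁻ (rank Y) (IsPerm-∋ (ρ-isPerm u) k∈) in y , y∈ , sym k≡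

unrank-correct : ∀ {Y : List ℕ} → Unique Y → ∀ {k} → InRange (length Y) k →
  unrank Y k ∈ Y × rank Y (unrank Y k) ≡ k
unrank-correct {Y} u k∈ = let _ , y∈ , r≡ = rank-surjective u k∈ in unrankIn-correct Y Y y∈ r≡

unrank-mono-< : ∀ {Y : List ℕ} → Unique Y → ∀ {k l} → InRange (length Y) k → InRange (length Y) l →
  k < l → unrank Y k < unrank Y l
unrank-mono-< {Y} u k∈ l∈ k<l = rank-cancel-< Y
  (subst₂ _<_ (sym (proj₂ (unrank-correct u k∈))) (sym (proj₂ (unrank-correct u l∈))) k<l)

unrank-injective : ∀ {Y : List ℕ} → Unique Y → ∀ {k l} → InRange (length Y) k → InRange (length Y) l →
  unrank Y k ≡ unrank Y l → k ≡ l
unrank-injective {Y} u k∈ l∈ u≡ =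
  trans (sym (proj₂ (unrank-correct u k∈))) (trans (cong (rank Y) u≡) (proj₂ (unrank-correct u l∈)))

unrank-resp-↭ : ∀ {Y Z : List ℕ} → Unique Y → Y ↭ Z → ∀ {k} → InRange (length Y) k →
  unrank Y k ≡ unrank Z k
unrank-resp-↭ {Y} {Z} u Y↭Z k∈@(1≤k , k≤) =
  let y∈ , ry≡ = unrank-correct u k∈
      z∈ , rz≡ = unrank-correct (Unique-resp-↭ Y↭Z u) (1≤k , subst (_ ≤_) (↭-length Y↭Z) k≤)
  in rank-injective Z (∈-resp-↭ Y↭Z y∈) z∈ (trans (sym (rank-resp-↭ Y↭Z _)) (trans ry≡ (sym rz≡)))

ρinv-ρ : ∀ {w Y : List ℕ} → w ↭ Y → ρinv Y (ρ w) ≡ w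
ρinv-ρ {w} {Y} w↭Y = trans (sym (map-∘ w)) (map-id-local (All.tabulate λ {x} x∈ →
  trans (cong (unrank Y) (rank-resp-↭ w↭Y x)) (unrank-rank Y (∈-resp-↭ w↭Y x∈))))

ρinv-↭ : ∀ {Y u : List ℕ} → Unique Y → IsPerm (length Y) u → ρinv Y u ↭ Y
ρinv-↭ {Y} {u} uY p = Unique∧⊆∧length≤⇒↭
  (Unique-map⁺ (unrank Y) (λ k∈ l∈ → unrank-injective uY (IsPerm-inRange p k∈) (IsPerm-inRange p l∈))
    (IsPerm-unique p))
  uY
  (λ y∈ → let k , k∈ , y≡ = ∈-map⁻ (unrank Y) y∈ in
    subst (_∈ Y) (sym y≡) (proj₁ (unrank-correct uY (IsPerm-inRange p k∈))))
  (≤-reflexive (sym (trans (length-map (unrank Y) u) (IsPerm-length p))))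

ρ-ρinv : ∀ {Y u : List ℕ} → Unique Y → IsPerm (length Y) u → ρ (ρinv Y u) ≡ u
ρ-ρinv {Y} {u} uY p = trans (sym (map-∘ u)) (map-id-local (All.tabulate λ {k} k∈ →
  trans (rank-resp-↭ (ρinv-↭ uY p) (unrank Y k)) (proj₂ (unrank-correct uY (IsPerm-inRange p k∈)))))

ρinv-resp-↭ : ∀ {Y Z u : List ℕ} → Unique Y → Y ↭ Z → IsPerm (length Y) u → ρinv Y u ≡ ρinv Z u
ρinv-resp-↭ uY Y↭Z p = map-cong-local (All.tabulate λ k∈ → unrank-resp-↭ uY Y↭Z (IsPerm-inRange p k∈))

ρinv-injective : ∀ {Y₁ Y₂ u₁ u₂ : List ℕ} → Unique Y₁ → Y₁ ↭ Y₂ →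
  IsPerm (length Y₁) u₁ → IsPerm (length Y₂) u₂ → ρinv Y₁ u₁ ≡ ρinv Y₂ u₂ → u₁ ≡ u₂
ρinv-injective {Y₁} {Y₂} {u₁} {u₂} uY Y↭ p₁ p₂ eq = begin
  u₁                ≡⟨ ρ-ρinv uY p₁ ⟨
  ρ (ρinv Y₁ u₁)    ≡⟨ cong ρ (trans eq (sym (ρinv-resp-↭ uY Y↭ p₂′))) ⟩
  ρ (ρinv Y₁ u₂)    ≡⟨ ρ-ρinv uY p₂′ ⟩
  u₂                ∎
  where
  open ≡-Reasoning
  p₂′ : IsPerm (length Y₁) u₂
  p₂′ = subst (λ l → IsPerm l u₂) (sym (↭-length Y↭)) p₂

ρ-injective : ∀ {Y₁ Y₂ : List ℕ} → Unique Y₁ → Y₁ ↭ Y₂ → ρ Y₁ ≡ ρ Y₂ → Y₁ ≡ Y₂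
ρ-injective {Y₁} {Y₂} uY Y↭ eq = begin
  Y₁                ≡⟨ ρinv-ρ ↭-refl ⟨
  ρinv Y₁ (ρ Y₁)    ≡⟨ cong (ρinv Y₁) eq ⟩
  ρinv Y₁ (ρ Y₂)    ≡⟨ ρinv-resp-↭ uY Y↭ (subst (IsPerm (length Y₁)) eq (ρ-isPerm uY)) ⟩
  ρinv Y₂ (ρ Y₂)    ≡⟨ ρinv-ρ ↭-refl ⟩
  Y₂                ∎
  where open ≡-Reasoning

starts-with-1 : ∀ {Z : List ℕ} → Unique Z → 1 ∈ Z → All (1 ≤_) Z → F (ρ Z) ≡ just 1 →
  ∃[ w'' ] (Z ≡ 1 ∷ w'')
starts-with-1 {z ∷ w''} uZ 1∈ (1≤z ∷ _) hd =
  w'' , cong (_∷ w'') (sym (rank-injective Z 1∈ (here refl) (≤-antisym rank-1≤rank-z rank-z≤rank-1)))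
  where
  Z = z ∷ w''
  rank-z≡1 : rank Z z ≡ 1
  rank-z≡1 = just-injective hd
  rank-1≤rank-z : rank Z 1 ≤ rank Z z
  rank-1≤rank-z = rank-mono-≤ Z 1≤z
  rank-z≤rank-1 : rank Z z ≤ rank Z 1
  rank-z≤rank-1 = subst (_≤ rank Z 1) (sym rank-z≡1) (proj₁ (rank-inRange Z 1∈))

reflect-inRange : ∀ {l x} → InRange l x → InRange l (suc l ∸ x)
reflect-inRange {l} {suc x} (_ , x<l) = subst (1 ≤_) (sym (+-∸-assoc 1 x<l)) (s≤s z≤n) , m∸n≤m l x

comp-≡-map : ∀ {l u} → IsPerm l u → comp u ≡ map (suc l ∸_) u
comp-≡-map {u = u} p = cong (λ L → map (suc L ∸_) u) (IsPerm-length p)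

comp-isPerm : ∀ {l u} → IsPerm l u → IsPerm l (comp u)
comp-isPerm {l} {u} p = subst (IsPerm l) (sym (comp-≡-map p)) (IsPerm-intro
  (Unique-map⁺ (suc l ∸_) (λ x∈ y∈ → ∸-cancelˡ-≡ (≤-suc x∈) (≤-suc y∈)) (IsPerm-unique p))
  (λ y∈ → let x , x∈ , y≡ = ∈-map⁻ (suc l ∸_) y∈ in
    subst (InRange l) (sym y≡) (reflect-inRange (IsPerm-inRange p x∈)))
  (trans (length-map (suc l ∸_) u) (IsPerm-length p)))
  where
  ≤-suc : ∀ {x} → x ∈ u → x ≤ suc l
  ≤-suc x∈ = m≤n⇒m≤1+n (proj₂ (IsPerm-inRange p x∈))

comp-involutive : ∀ {l u} → IsPerm l u → comp (comp u) ≡ u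
comp-involutive {l} {u} p = begin
  comp (comp u)                     ≡⟨ comp-≡-map (comp-isPerm p) ⟩
  map (suc l ∸_) (comp u)           ≡⟨ cong (map (suc l ∸_)) (comp-≡-map p) ⟩
  map (suc l ∸_) (map (suc l ∸_) u) ≡⟨ map-∘ u ⟨
  map (λ x → suc l ∸ (suc l ∸ x)) u ≡⟨ map-id-local (All.tabulate λ x∈ →
                                        m∸[m∸n]≡n (m≤n⇒m≤1+n (proj₂ (IsPerm-inRange p x∈)))) ⟩
  u                                 ∎
  where open ≡-Reasoning

-- Alternating words

Alternating : Bool → List ℕ → Set
Alternating true  = Up
Alternating false = Down

Step : Bool → ℕ → ℕ → Set
Step true  x y = x < y
Step false x y = y < x

Alternating-∷⁻ : ∀ b {x y r} → Alternating b (x ∷ y ∷ r) → Step b x y × Alternating (not b) (y ∷ r)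
Alternating-∷⁻ true  a = a
Alternating-∷⁻ false a = a

Alternating-∷⁺ : ∀ b {x y r} → Step b x y → Alternating (not b) (y ∷ r) → Alternating b (x ∷ y ∷ r)
Alternating-∷⁺ true  s a = s , a
Alternating-∷⁺ false s a = s , a

Alternating-short : ∀ b {u : List ℕ} → length u ≤ 1 → Alternating b u
Alternating-short true  {[]}    _ = _
Alternating-short true  {_ ∷ []} _ = _
Alternating-short false {[]}    _ = _
Alternating-short false {_ ∷ []} _ = _
Alternating-short b {_ ∷ _ ∷ _} (s≤s ())

MonotoneOn AntitoneOn : (ℕ → ℕ) → List ℕ → Set
MonotoneOn f u = ∀ {x y} → x ∈ u → y ∈ u → x < y → f x < f y
AntitoneOn f u = ∀ {x y} → x ∈ u → y ∈ u → x < y → f y < f x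

Alternating-map-mono : ∀ b (f : ℕ → ℕ) (u : List ℕ) → MonotoneOn f u → Alternating b u →
  Alternating b (map f u)
Alternating-map-mono b f []          _    _ = Alternating-short b z≤n
Alternating-map-mono b f (_ ∷ [])    _    _ = Alternating-short b ≤-refl
Alternating-map-mono b f (x ∷ y ∷ r) mono a =
  let s , a′ = Alternating-∷⁻ b a in
  Alternating-∷⁺ b (step b s)
    (Alternating-map-mono (not b) f (y ∷ r) (λ x∈ y∈ → mono (there x∈) (there y∈)) a′)
  where
  step : ∀ b → Step b x y → Step b (f x) (f y)
  step true  x<y = mono (here refl) (there (here refl)) x<y
  step false y<x = mono (there (here refl)) (here refl) y<x

Alternating-map-anti : ∀ b (f : ℕ → ℕ) (u : List ℕ) → AntitoneOn f u → Alternating b u →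
  Alternating (not b) (map f u)
Alternating-map-anti b f []          _    _ = Alternating-short (not b) z≤n
Alternating-map-anti b f (_ ∷ [])    _    _ = Alternating-short (not b) ≤-refl
Alternating-map-anti b f (x ∷ y ∷ r) anti a =
  let s , a′ = Alternating-∷⁻ b a in
  Alternating-∷⁺ (not b) (step b s)
    (Alternating-map-anti (not b) f (y ∷ r) (λ x∈ y∈ → anti (there x∈) (there y∈)) a′)
  where
  step : ∀ b → Step b x y → Step (not b) (f x) (f y)
  step true  x<y = anti (here refl) (there (here refl)) x<y
  step false y<x = anti (there (here refl)) (here refl) y<x

phaseAfter : List ℕ → Bool → Bool
phaseAfter []      b = b
phaseAfter (_ ∷ u) b = phaseAfter u (not b)

phaseAfter-true : ∀ (u : List ℕ) → phaseAfter u true ≡ isEven (length u)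
phaseAfter-true []          = refl
phaseAfter-true (_ ∷ [])    = refl
phaseAfter-true (_ ∷ _ ∷ u) = phaseAfter-true u

-- Enough for c to be entered from the last letter of u when the step leaving c goes in direction t.
Junction : Bool → ℕ → List ℕ → Set
Junction true  c u = All (c <_) u
Junction false c u = All (_< c) u

Alternating-++⁺ : ∀ b (u : List ℕ) c v → Alternating b u → Junction (phaseAfter u b) c u →
  Alternating (phaseAfter u b) (c ∷ v) → Alternating b (u ++ c ∷ v)
Alternating-++⁺ b     []          c v _ _          a = a
Alternating-++⁺ true  (_ ∷ [])    c v _ (x<c ∷ []) a = x<c , a
Alternating-++⁺ false (_ ∷ [])    c v _ (c<x ∷ []) a = c<x , a
Alternating-++⁺ b     (x ∷ y ∷ u) c v a j a′ =
  let s , a″ = Alternating-∷⁻ b a in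
  Alternating-∷⁺ b s (Alternating-++⁺ (not b) (y ∷ u) c v a″ (junction-tail _ j) a′)
  where
  junction-tail : ∀ t → Junction t c (x ∷ y ∷ u) → Junction t c (y ∷ u)
  junction-tail true  (_ ∷ j) = j
  junction-tail false (_ ∷ j) = j

Alternating-++⁻ : ∀ b (u : List ℕ) c v → Alternating b (u ++ c ∷ v) →
  Alternating b u × Alternating (phaseAfter u b) (c ∷ v) ×
  (u ≢ [] → ∃[ x ] (x ∈ u × Step (not (phaseAfter u b)) x c))
Alternating-++⁻ b     []          c v a         = Alternating-short b z≤n , a , λ u≢[] → ⊥-elim (u≢[] refl)
Alternating-++⁻ true  (x ∷ [])    c v (x<c , a) = _ , a , λ _ → x , here refl , x<c
Alternating-++⁻ false (x ∷ [])    c v (c<x , a) = _ , a , λ _ → x , here refl , c<x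
Alternating-++⁻ b     (x ∷ y ∷ u) c v a =
  let s , a′ = Alternating-∷⁻ b a
      au , acv , last = Alternating-++⁻ (not b) (y ∷ u) c v a′
      z , z∈ , step = last (λ ())
  in Alternating-∷⁺ b s au , acv , λ _ → z , there z∈ , step

Up-∷⁻ : ∀ {x u} → Up (x ∷ u) → Down u
Up-∷⁻ {u = []}    _        = _
Up-∷⁻ {u = _ ∷ _} (_ , d) = d

Up-∷ : ∀ {x u} → Down u → All (x <_) u → Up (x ∷ u)
Up-∷ {u = []}    _ _         = _
Up-∷ {u = _ ∷ _} d (x<y ∷ _) = x<y , d

-- André I words and relabelling

AndreI-map : ∀ (f : ℕ → ℕ) {w} → MonotoneOn f w → AndreI w → AndreI (map f w)
AndreI-map f mono andre-e       = andre-e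
AndreI-map f mono (andre-one x) = andre-one (f x)
AndreI-map f mono (andre-split v m v' m<vv' av av' (x , x∈v' , vv'≤x)) =
  subst AndreI (sym (map-++ f v (m ∷ v')))
    (andre-split (map f v) (f m) (map f v')
      (subst (All (f m <_)) (map-++ f v v')
        (All-map⁺ (All.tabulate λ y∈ → mono m∈ (++⊆++-∷ v v' y∈) (All.lookup m<vv' y∈))))
      (AndreI-map f (λ y∈ z∈ → mono (∈-++⁺ˡ y∈) (∈-++⁺ˡ z∈)) av)
      (AndreI-map f (λ y∈ z∈ → mono (∈-++⁺ʳ v (there y∈)) (∈-++⁺ʳ v (there z∈))) av')
      (f x , ∈-map⁺ f x∈v' , subst (All (_≤ f x)) (map-++ f v v')
        (All-map⁺ (All.tabulate λ y∈ →
          mono-≤ (++⊆++-∷ v v' y∈) (++⊆++-∷ v v' (∈-++⁺ʳ v x∈v')) (All.lookup vv'≤x y∈)))))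
  where
  m∈ : m ∈ v ++ m ∷ v'
  m∈ = ∈-++⁺ʳ v (here refl)
  mono-≤ : ∀ {y z} → y ∈ v ++ m ∷ v' → z ∈ v ++ m ∷ v' → y ≤ z → f y ≤ f z
  mono-≤ y∈ z∈ y≤z with m≤n⇒m<n∨m≡n y≤z
  ... | inj₁ y<z  = <⇒≤ (mono y∈ z∈ y<z)
  ... | inj₂ refl = ≤-refl

AndreI-∷⁺ : ∀ {x w M} → All (x <_) w → AndreI w → M ∈ w → All (_≤ M) w → AndreI (x ∷ w)
AndreI-∷⁺ {x} {w} x<w aw M∈ w≤M = andre-split [] x w x<w andre-e aw (_ , M∈ , w≤M)

AndreI-∷⁻ : ∀ {x w} → All (x <_) w → AndreI (x ∷ w) → AndreI w
AndreI-∷⁻ x<w a = go x<w a refl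
  where
  go : ∀ {x w u} → All (x <_) w → AndreI u → u ≡ x ∷ w → AndreI w
  go _   (andre-one _)                        refl = andre-e
  go _   (andre-split []      _ _ _ _ av' _) refl = av'
  go x<w (andre-split (_ ∷ v) m v' m<vv' _ _ _) refl =
    ⊥-elim (<-asym (All.lookup x<w (∈-++⁺ʳ v (here refl))) (All.lookup m<vv' (here refl)))

ρ-alternating : ∀ b (w : List ℕ) → Alternating b w → Alternating b (ρ w)
ρ-alternating b w = Alternating-map-mono b (rank w) w (λ _ y∈ x<y → rank-mono-< w x<y y∈)

ρ-AndreI : ∀ {w : List ℕ} → AndreI w → AndreI (ρ w)
ρ-AndreI {w} = AndreI-map (rank w) (λ _ y∈ x<y → rank-mono-< w x<y y∈)

unrank-monotoneOn : ∀ {Y u : List ℕ} → Unique Y → IsPerm (length Y) u → MonotoneOn (unrank Y) u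
unrank-monotoneOn uY p k∈ l∈ = unrank-mono-< uY (IsPerm-inRange p k∈) (IsPerm-inRange p l∈)

ρinv-alternating : ∀ b {Y u : List ℕ} → Unique Y → IsPerm (length Y) u → Alternating b u →
  Alternating b (ρinv Y u)
ρinv-alternating b {Y} {u} uY p = Alternating-map-mono b (unrank Y) u (unrank-monotoneOn uY p)

ρinv-AndreI : ∀ {Y u : List ℕ} → Unique Y → IsPerm (length Y) u → AndreI u → AndreI (ρinv Y u)
ρinv-AndreI {Y} uY p = AndreI-map (unrank Y) (unrank-monotoneOn uY p)

comp-alternating : ∀ b {l u} → IsPerm l u → Alternating b u → Alternating (not b) (comp u)
comp-alternating b {l} {u} p a = subst (Alternating (not b)) (sym (comp-≡-map p))
  (Alternating-map-anti b (suc l ∸_) u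
    (λ _ y∈ x<y → ∸-monoʳ-< x<y (m≤n⇒m≤1+n (proj₂ (IsPerm-inRange p y∈)))) a)

compUnless : Bool → List ℕ → List ℕ
compUnless true  u = u
compUnless false u = comp u

compUnless-isPerm : ∀ t {l u} → IsPerm l u → IsPerm l (compUnless t u)
compUnless-isPerm true  p = p
compUnless-isPerm false p = comp-isPerm p

compUnless-involutive : ∀ t {l u} → IsPerm l u → compUnless t (compUnless t u) ≡ u
compUnless-involutive true  p = refl
compUnless-involutive false p = comp-involutive p

compUnless-up : ∀ t {l u} → IsPerm l u → Up u → Alternating t (compUnless t u)
compUnless-up true  p a = a
compUnless-up false p a = comp-alternating true p a

compUnless-toUp : ∀ t {l u} → IsPerm l u → Alternating t u → Up (compUnless t u)
compUnless-toUp true  p a = a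
compUnless-toUp false p a = comp-alternating false p a

-- Unfolding η

ηBody : ℕ → List ℕ × List ℕ → List ℕ
ηBody f ([] , w'') = 1 ∷ ρinv w'' (comp (ηf f (ρ w'')))
ηBody f (w'@(_ ∷ _) , w'') =
  ρinv w' (ηf f (ρ w')) ++
  ρinv (1 ∷ w'') (if isEven (length w') then ηf f (ρ (1 ∷ w'')) else comp (ηf f (ρ (1 ∷ w''))))

ηf-1 : ∀ f → ηf f (1 ∷ []) ≡ 1 ∷ []
ηf-1 zero    = refl
ηf-1 (suc f) = refl

ηf-12 : ∀ f → ηf f (1 ∷ 2 ∷ []) ≡ 1 ∷ 2 ∷ []
ηf-12 zero    = refl
ηf-12 (suc f) = refl

-- The words are split just far enough to get past the literal base clauses of ηf;
-- the base cases 12, 123 and 213 agree with the general clause.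
ηf-suc-general : ∀ f w → w ≢ [] → w ≢ 1 ∷ [] → ηf (suc f) w ≡ ηBody f (splitAt1 w)
ηf-suc-general f []                  ≢[] _   = ⊥-elim (≢[] refl)
ηf-suc-general f (1 ∷ [])            _   ≢1 = ⊥-elim (≢1 refl)
ηf-suc-general f (1 ∷ 2 ∷ [])        _ _ rewrite ηf-1 f = refl
ηf-suc-general f (1 ∷ 2 ∷ 3 ∷ [])    _ _ rewrite ηf-12 f = refl
ηf-suc-general f (2 ∷ 1 ∷ 3 ∷ [])    _ _ rewrite ηf-1 f | ηf-12 f = refl
ηf-suc-general f w@(0 ∷ _)                       _ _ with splitAt1 w
... | [] , _ = refl
... | _ ∷ _ , _ = refl
ηf-suc-general f w@(1 ∷ 0 ∷ _)                   _ _ with splitAt1 w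
... | [] , _ = refl
... | _ ∷ _ , _ = refl
ηf-suc-general f w@(1 ∷ 1 ∷ _)                   _ _ with splitAt1 w
... | [] , _ = refl
... | _ ∷ _ , _ = refl
ηf-suc-general f w@(1 ∷ 2 ∷ 0 ∷ _)               _ _ with splitAt1 w
... | [] , _ = refl
... | _ ∷ _ , _ = refl
ηf-suc-general f w@(1 ∷ 2 ∷ 1 ∷ _)               _ _ with splitAt1 w
... | [] , _ = refl
... | _ ∷ _ , _ = refl
ηf-suc-general f w@(1 ∷ 2 ∷ 2 ∷ _)               _ _ with splitAt1 w
... | [] , _ = refl
... | _ ∷ _ , _ = refl
ηf-suc-general f w@(1 ∷ 2 ∷ 3 ∷ _ ∷ _)           _ _ with splitAt1 w
... | [] , _ = refl
... | _ ∷ _ , _ = refl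
ηf-suc-general f w@(1 ∷ 2 ∷ suc (suc (suc (suc _))) ∷ _) _ _ with splitAt1 w
... | [] , _ = refl
... | _ ∷ _ , _ = refl
ηf-suc-general f w@(1 ∷ suc (suc (suc _)) ∷ _)   _ _ with splitAt1 w
... | [] , _ = refl
... | _ ∷ _ , _ = refl
ηf-suc-general f w@(2 ∷ [])                      _ _ with splitAt1 w
... | [] , _ = refl
... | _ ∷ _ , _ = refl
ηf-suc-general f w@(2 ∷ 0 ∷ _)                   _ _ with splitAt1 w
... | [] , _ = refl
... | _ ∷ _ , _ = refl
ηf-suc-general f w@(2 ∷ 1 ∷ [])                  _ _ with splitAt1 w
... | [] , _ = refl
... | _ ∷ _ , _ = refl
ηf-suc-general f w@(2 ∷ 1 ∷ 0 ∷ _)               _ _ with splitAt1 w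
... | [] , _ = refl
... | _ ∷ _ , _ = refl
ηf-suc-general f w@(2 ∷ 1 ∷ 1 ∷ _)               _ _ with splitAt1 w
... | [] , _ = refl
... | _ ∷ _ , _ = refl
ηf-suc-general f w@(2 ∷ 1 ∷ 2 ∷ _)               _ _ with splitAt1 w
... | [] , _ = refl
... | _ ∷ _ , _ = refl
ηf-suc-general f w@(2 ∷ 1 ∷ 3 ∷ _ ∷ _)           _ _ with splitAt1 w
... | [] , _ = refl
... | _ ∷ _ , _ = refl
ηf-suc-general f w@(2 ∷ 1 ∷ suc (suc (suc (suc _))) ∷ _) _ _ with splitAt1 w
... | [] , _ = refl
... | _ ∷ _ , _ = refl
ηf-suc-general f w@(2 ∷ suc (suc _) ∷ _)         _ _ with splitAt1 w
... | [] , _ = refl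
... | _ ∷ _ , _ = refl
ηf-suc-general f w@(suc (suc (suc _)) ∷ _)       _ _ with splitAt1 w
... | [] , _ = refl
... | _ ∷ _ , _ = refl

piece : ℕ → Bool → List ℕ → List ℕ
piece f t Z = ρinv Z (compUnless t (ηf f (ρ Z)))

ηPrefix : ℕ → List ℕ → List ℕ
ηPrefix f []         = []
ηPrefix f w'@(_ ∷ _) = piece f true w'

ηSuffix : ℕ → List ℕ → List ℕ → List ℕ
ηSuffix f []         w'' = 1 ∷ piece f false w''
ηSuffix f w'@(_ ∷ _) w'' = piece f (isEven (length w')) (1 ∷ w'')

-- The cut between ηPrefix and ηSuffix is made before the first letter in {1, n} of η(w′ 1 w″).
ηStep : ℕ → List ℕ → List ℕ → List ℕ
ηStep f w' w'' = ηPrefix f w' ++ ηSuffix f w' w''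

ηBody≡ηStep : ∀ f (w' w'' : List ℕ) → ηBody f (w' , w'') ≡ ηStep f w' w''
ηBody≡ηStep f []       w'' = refl
ηBody≡ηStep f (x ∷ w') w'' with isEven (length (x ∷ w'))
... | true  = refl
... | false = refl

splitAt1-++ : ∀ (w' w'' : List ℕ) → 1 ∉ w' → splitAt1 (w' ++ 1 ∷ w'') ≡ (w' , w'')
splitAt1-++ []       w'' _  = refl
splitAt1-++ (x ∷ w') w'' 1∉ with x ≟ 1
... | yes refl = ⊥-elim (1∉ (here refl))
... | no _ rewrite splitAt1-++ w' w'' (1∉ ∘ there) = refl

ηf-suc : ∀ f (w' w'' : List ℕ) → 1 ∉ w' → w'' ≢ [] → ηf (suc f) (w' ++ 1 ∷ w'') ≡ ηStep f w' w''
ηf-suc f w' w'' 1∉ w''≢[] = begin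
  ηf (suc f) (w' ++ 1 ∷ w'')         ≡⟨ ηf-suc-general f (w' ++ 1 ∷ w'') (nonempty w') (not-1 w') ⟩
  ηBody f (splitAt1 (w' ++ 1 ∷ w'')) ≡⟨ cong (ηBody f) (splitAt1-++ w' w'' 1∉) ⟩
  ηBody f (w' , w'')                 ≡⟨ ηBody≡ηStep f w' w'' ⟩
  ηStep f w' w''                     ∎
  where
  open ≡-Reasoning
  nonempty : ∀ v → v ++ 1 ∷ w'' ≢ []
  nonempty []      ()
  nonempty (_ ∷ _) ()
  not-1 : ∀ v → v ++ 1 ∷ w'' ≢ 1 ∷ []
  not-1 []          eq = w''≢[] (∷-injectiveʳ eq)
  not-1 (_ ∷ [])    ()
  not-1 (_ ∷ _ ∷ _) ()

ηStep-nonempty : ∀ f {w'} w'' → 1 ≤ length w' →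
  ηStep f w' w'' ≡ piece f true w' ++ piece f (isEven (length w')) (1 ∷ w'')
ηStep-nonempty f {_ ∷ _} w'' _ = refl

-- The induction

-- η w runs ηf with fuel |w|; the invariant is proved for every fuel f ≥ n, which also covers the
-- recursive calls (one unit of fuel per strictly shorter argument).
record Correct (n f : ℕ) : Set where
  field
    alternating    : ∀ {w} → AndI n w → Alt n (ηf f w)
    head-preserved : ∀ {w} → AndI n w → F w ≡ F (ηf f w)
    injective      : ∀ {w₁ w₂} → AndI n w₁ → AndI n w₂ → ηf f w₁ ≡ ηf f w₂ → w₁ ≡ w₂
    surjective     : ∀ {u} → Alt n u → ∃[ w ] (AndI n w × ηf f w ≡ u)

CorrectBelow : ℕ → Set
CorrectBelow n = ∀ {m} → m < n → 1 ≤ m → ∀ {f} → m ≤ f → Correct m f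

Small : ℕ → List ℕ → Set
Small n Z = 1 ≤ length Z × length Z < n

F-just⇒∷ : ∀ {x} (u : List ℕ) → just x ≡ F u → ∃[ u' ] (u ≡ x ∷ u')
F-just⇒∷ (x ∷ u) refl = u , refl

module Pieces {n f : ℕ} (ih : CorrectBelow n) (n≤1+f : n ≤ suc f) where

  correct-small : ∀ {Z} → Small n Z → Correct (length Z) f
  correct-small (1≤ , <n) = ih <n 1≤ (≤-pred (≤-trans <n n≤1+f))

  module _ {Z : List ℕ} (uZ : Unique Z) (aZ : AndreI Z) (small : Small n Z) where
    private
      open Correct (correct-small {Z} small)
      ηρZ-alt : Alt (length Z) (ηf f (ρ Z))
      ηρZ-alt = alternating (ρ-isPerm uZ , ρ-AndreI aZ)

    ηρ-isPerm : IsPerm (length Z) (ηf f (ρ Z))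
    ηρ-isPerm = proj₁ ηρZ-alt

    piece-↭ : ∀ t → piece f t Z ↭ Z
    piece-↭ t = ρinv-↭ uZ (compUnless-isPerm t ηρ-isPerm)

    piece-alternating : ∀ t → Alternating t (piece f t Z)
    piece-alternating t = ρinv-alternating t uZ (compUnless-isPerm t ηρ-isPerm)
      (compUnless-up t ηρ-isPerm (proj₂ ηρZ-alt))

    ηρ-head : F (ρ Z) ≡ F (ηf f (ρ Z))
    ηρ-head = head-preserved (ρ-isPerm uZ , ρ-AndreI aZ)

  piece-head-true : ∀ {z Z} → Unique (z ∷ Z) → AndreI (z ∷ Z) → Small n (z ∷ Z) →
    ∃[ B ] (piece f true (z ∷ Z) ≡ z ∷ B)
  piece-head-true {z} {Z} uZ aZ small with F-just⇒∷ (ηf f (ρ (z ∷ Z))) (ηρ-head uZ aZ small)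
  ... | E , eq = map (unrank (z ∷ Z)) E ,
    trans (cong (ρinv (z ∷ Z)) eq) (cong (_∷ map (unrank (z ∷ Z)) E) (unrank-rank (z ∷ Z) (here refl)))

  piece-injective : ∀ t {Z₁ Z₂} → Unique Z₁ → Z₁ ↭ Z₂ → AndreI Z₁ → AndreI Z₂ → Small n Z₁ →
    piece f t Z₁ ≡ piece f t Z₂ → Z₁ ≡ Z₂
  piece-injective t {Z₁} {Z₂} u₁ Z↭ a₁ a₂ small eq =
    ρ-injective u₁ Z↭ (injective ρZ₁-AndI ρZ₂-AndI (compUnless-injective
      (ρinv-injective u₁ Z↭ (compUnless-isPerm t E₁-perm) (compUnless-isPerm t E₂-perm) eq)))
    where
    open Correct (correct-small {Z₁} small)
    len≡ : length Z₂ ≡ length Z₁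
    len≡ = sym (↭-length Z↭)
    ρZ₁-AndI : AndI (length Z₁) (ρ Z₁)
    ρZ₁-AndI = ρ-isPerm u₁ , ρ-AndreI a₁
    ρZ₂-AndI : AndI (length Z₁) (ρ Z₂)
    ρZ₂-AndI = subst (λ l → AndI l (ρ Z₂)) len≡ (ρ-isPerm (Unique-resp-↭ Z↭ u₁) , ρ-AndreI a₂)
    E₁-perm : IsPerm (length Z₁) (ηf f (ρ Z₁))
    E₁-perm = proj₁ (alternating ρZ₁-AndI)
    E₂-perm : IsPerm (length Z₂) (ηf f (ρ Z₂))
    E₂-perm = subst (λ l → IsPerm l _) (sym len≡) (proj₁ (alternating ρZ₂-AndI))
    compUnless-injective : compUnless t (ηf f (ρ Z₁)) ≡ compUnless t (ηf f (ρ Z₂)) →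
      ηf f (ρ Z₁) ≡ ηf f (ρ Z₂)
    compUnless-injective e = begin
      ηf f (ρ Z₁)                                 ≡⟨ compUnless-involutive t E₁-perm ⟨
      compUnless t (compUnless t (ηf f (ρ Z₁)))   ≡⟨ cong (compUnless t) e ⟩
      compUnless t (compUnless t (ηf f (ρ Z₂)))   ≡⟨ compUnless-involutive t E₂-perm ⟩
      ηf f (ρ Z₂)                                 ∎
      where open ≡-Reasoning

  piece-surjective : ∀ t {V} → Unique V → Alternating t V → Small n V →
    ∃[ Z ] (Z ↭ V × AndreI Z × piece f t Z ≡ V × F (ρ Z) ≡ F (compUnless t (ρ V)))
  piece-surjective t {V} uV altV small =
    let W , aW , ηW≡Q = surjective Q-alt in ρinv V W , preimage aW ηW≡Q
    where
    open Correct (correct-small {V} small)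
    Q = compUnless t (ρ V)
    Q-alt : Alt (length V) Q
    Q-alt = compUnless-isPerm t (ρ-isPerm uV) , compUnless-toUp t (ρ-isPerm uV) (ρ-alternating t V altV)
    preimage : ∀ {W} → AndI (length V) W → ηf f W ≡ Q →
      ρinv V W ↭ V × AndreI (ρinv V W) × piece f t (ρinv V W) ≡ V × F (ρ (ρinv V W)) ≡ F Q
    preimage {W} aW@(pW , andreW) ηW≡Q =
      Z↭V , ρinv-AndreI uV pW andreW , piece≡V , trans (cong F ρZ≡W) (trans (head-preserved aW) (cong F ηW≡Q))
      where
      open ≡-Reasoning
      Z = ρinv V W
      Z↭V : Z ↭ V
      Z↭V = ρinv-↭ uV pW
      ρZ≡W : ρ Z ≡ W
      ρZ≡W = ρ-ρinv uV pW
      piece≡V : piece f t Z ≡ V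
      piece≡V = begin
        ρinv Z (compUnless t (ηf f (ρ Z)))  ≡⟨ cong (λ E → ρinv Z (compUnless t (ηf f E))) ρZ≡W ⟩
        ρinv Z (compUnless t (ηf f W))      ≡⟨ cong (ρinv Z ∘ compUnless t) ηW≡Q ⟩
        ρinv Z (compUnless t Q)             ≡⟨ cong (ρinv Z) (compUnless-involutive t (ρ-isPerm uV)) ⟩
        ρinv Z (ρ V)                        ≡⟨ ρinv-resp-↭ (Unique-resp-↭ (↭-sym Z↭V) uV) Z↭V
                                               (subst (λ l → IsPerm l (ρ V)) (↭-length (↭-sym Z↭V)) (ρ-isPerm uV)) ⟩
        ρinv V (ρ V)                        ≡⟨ ρinv-ρ ↭-refl ⟩
        V                                   ∎

record Factorisation (n : ℕ) (w' w'' : List ℕ) : Set where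
  field
    isPerm     : IsPerm n (w' ++ 1 ∷ w'')
    andre-w'   : AndreI w'
    andre-w''  : AndreI w''
    n∈w''      : n ∈ w''

  unique : Unique (w' ++ 1 ∷ w'')
  unique = IsPerm-unique isPerm

  unique-w' : Unique w'
  unique-w' = Unique-++⁻ˡ w' unique

  unique-1w'' : Unique (1 ∷ w'')
  unique-1w'' = Unique-++⁻ʳ w' unique

  1∉w' : 1 ∉ w'
  1∉w' 1∈ = Unique-++-disjoint w' unique 1∈ (here refl)

  inRange : ∀ {x} → x ∈ w' ++ 1 ∷ w'' → InRange n x
  inRange = IsPerm-inRange isPerm

  1<w'' : ∀ {x} → x ∈ w'' → 1 < x
  1<w'' = All.lookup (Unique-∷-least unique-1w'' (proj₁ ∘ inRange ∘ ∈-++⁺ʳ w' ∘ there))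

  1<w' : ∀ {x} → x ∈ w' → 1 < x
  1<w' x∈ = ≤∧≢⇒< (proj₁ (inRange (∈-++⁺ˡ x∈))) (λ { refl → 1∉w' x∈ })

  w'<n : ∀ {x} → x ∈ w' → x < n
  w'<n x∈ = ≤∧≢⇒< (proj₂ (inRange (∈-++⁺ˡ x∈)))
    (λ { refl → Unique-++-disjoint w' unique x∈ (there n∈w'') })

  andre-1w'' : AndreI (1 ∷ w'')
  andre-1w'' = AndreI-∷⁺ (All.tabulate 1<w'') andre-w'' n∈w''
    (All.tabulate (λ x∈ → proj₂ (inRange (∈-++⁺ʳ w' (there x∈)))))

  length-split : length w' + length (1 ∷ w'') ≡ n
  length-split = trans (sym (length-++ w')) (IsPerm-length isPerm)

data Factorised (n : ℕ) : List ℕ → Set where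
  factorised : ∀ {w' w''} → Factorisation n w' w'' → Factorised n (w' ++ 1 ∷ w'')

factorise : ∀ {n w} → 2 ≤ n → AndI n w → Factorised n w
factorise 2≤n (p , andre-e)     = ⊥-elim (<⇒≱ 2≤n (subst (_≤ 1) (IsPerm-length p) z≤n))
factorise 2≤n (p , andre-one _) = ⊥-elim (<⇒≱ 2≤n (subst (_≤ 1) (IsPerm-length p) ≤-refl))
factorise {n} 2≤n (p , andre-split v m v' m<vv' av av' (M , M∈v' , vv'≤M))
  with ∈-++-∷⁻ v (IsPerm-∋ p (≤-refl , ≤-trans (s≤s z≤n) 2≤n))
... | inj₂ 1∈vv' = ⊥-elim (<⇒≱ (All.lookup m<vv' 1∈vv') (proj₁ (IsPerm-inRange p (∈-++⁺ʳ v (here refl)))))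
... | inj₁ refl = factorised (record
  { isPerm     = p
  ; andre-w'   = av
  ; andre-w''  = av'
  ; n∈w''      = subst (_∈ v') (≤-antisym M≤n n≤M) M∈v'
  })
  where
  n∈vv' : n ∈ v ++ v'
  n∈vv' with ∈-++-∷⁻ v (IsPerm-∋ p (≤-trans (s≤s z≤n) 2≤n , ≤-refl))
  ... | inj₁ refl = ⊥-elim (<⇒≱ 2≤n ≤-refl)
  ... | inj₂ n∈   = n∈
  n≤M : n ≤ M
  n≤M = All.lookup vv'≤M n∈vv'
  M≤n : M ≤ n
  M≤n = proj₂ (IsPerm-inRange p (∈-++⁺ʳ v (there M∈v')))

unfactorise : ∀ {n w' w''} → Factorisation n w' w'' → AndI n (w' ++ 1 ∷ w'')
unfactorise {n} {w'} {w''} fac = isPerm , andre-split w' 1 w''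
  (All.tabulate (λ x∈ → [ 1<w' , 1<w'' ]′ (∈-++⁻ w' x∈))) andre-w' andre-w''
  (n , n∈w'' , All.tabulate (λ x∈ → proj₂ (inRange (++⊆++-∷ w' w'' x∈))))
  where
  open Factorisation fac

extreme : Bool → ℕ → ℕ
extreme true  n = 1
extreme false n = n

Extreme : ℕ → ℕ → Set
Extreme n x = x ≡ 1 ⊎ x ≡ n

extreme? : ∀ n → Decidable (Extreme n)
extreme? n x = (x ≟ 1) ⊎-dec (x ≟ n)

Extreme-extreme : ∀ t {n} → Extreme n (extreme t n)
Extreme-extreme true  = inj₁ refl
Extreme-extreme false = inj₂ refl

extreme-junction : ∀ t {n u} → All (1 <_) u → All (_< n) u → Junction t (extreme t n) u
extreme-junction true  1<u _   = 1<u
extreme-junction false _   u<n = u<n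

max-cannot-start : ∀ {n B} → 2 ≤ n → IsPerm n (n ∷ B) → Up (n ∷ B) → ⊥
max-cannot-start {B = []}    2≤n p _         = <⇒≱ 2≤n (≤-reflexive (sym (IsPerm-length p)))
max-cannot-start {B = _ ∷ _} 2≤n p (n<b , _) = <⇒≱ n<b (proj₂ (IsPerm-inRange p (there (here refl))))

small-++ : ∀ {n} (A S : List ℕ) → length A + length S ≡ n → 1 ≤ length A → 1 ≤ length S →
  Small n A × Small n S
small-++ A S len 1≤A 1≤S =
  (1≤A , subst (length A <_) len (m<m+n (length A) 1≤S)) ,
  (1≤S , subst (length S <_) len (m<n+m (length S) 1≤A))

extreme-inRange : ∀ {n x} → 2 ≤ n → Extreme n x → InRange n x
extreme-inRange 2≤n (inj₁ refl) = ≤-refl , ≤-trans (s≤s z≤n) 2≤n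
extreme-inRange 2≤n (inj₂ refl) = ≤-trans (s≤s z≤n) 2≤n , ≤-refl

extreme-after : ∀ t {n c x} → Extreme n c → InRange n x → Step (not t) x c → c ≡ extreme t n
extreme-after true  (inj₁ refl) _         _   = refl
extreme-after true  (inj₂ refl) (_ , x≤n) n<x = ⊥-elim (<⇒≱ n<x x≤n)
extreme-after false (inj₁ refl) (1≤x , _) x<1 = ⊥-elim (<⇒≱ x<1 1≤x)
extreme-after false (inj₂ refl) _         _   = refl

-- The complement turns the maximal rank |nB| into 1.
compUnless-ρ-head : ∀ t {n B} → Unique (extreme t n ∷ B) → All (InRange n) B →
  F (compUnless t (ρ (extreme t n ∷ B))) ≡ just 1
compUnless-ρ-head true  {B = B} u B∈ =
  cong (just ∘ suc) (rank-of-strictLowerBound B (Unique-∷-least u (proj₁ ∘ All.lookup B∈)))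
compUnless-ρ-head false {n} {B} _ B∈ = cong just (begin
  suc (length (ρ (n ∷ B))) ∸ rank (n ∷ B) n ≡⟨ cong₂ (λ l r → suc l ∸ r) (length-map (rank (n ∷ B)) (n ∷ B))
                                                (rank-of-upperBound (n ∷ B) (≤-refl ∷ All.map proj₂ B∈)) ⟩
  suc (length (n ∷ B)) ∸ length (n ∷ B)      ≡⟨ m+n∸n≡m 1 (length (n ∷ B)) ⟩
  1                                          ∎)
  where open ≡-Reasoning

Up-++-extreme : ∀ {n} A {c B} → 1 ≤ length A → IsPerm n (A ++ c ∷ B) → Up (A ++ c ∷ B) → Extreme n c →
  Up A × Alternating (isEven (length A)) (c ∷ B) × c ≡ extreme (isEven (length A)) n
Up-++-extreme A@(_ ∷ _) {c} {B} _ p up c-ext =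
  let upA , altS , last = Alternating-++⁻ true A c B up
      x , x∈A , step = last (λ ())
  in upA , subst (λ b → Alternating b (c ∷ B)) (phaseAfter-true A) altS ,
     extreme-after _ c-ext (IsPerm-inRange p (∈-++⁺ˡ x∈A)) (subst (λ b → Step (not b) x c) (phaseAfter-true A) step)

module InductiveStep {n f : ℕ} (ih : CorrectBelow n) (n≤1+f : n ≤ suc f) where
  open Pieces ih n≤1+f

  small-split : ∀ {w' w''} → Factorisation n w' w'' → 1 ≤ length w' → Small n w' × Small n (1 ∷ w'')
  small-split {w'} {w''} fac 1≤ = small-++ w' (1 ∷ w'') (Factorisation.length-split fac) 1≤ (s≤s z≤n)

  small-w'' : ∀ {w''} → Factorisation n [] w'' → Small n w''
  small-w'' {[]}      fac with () ← Factorisation.n∈w'' fac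
  small-w'' {_ ∷ w''} fac = s≤s z≤n , subst (suc (length w'') <_) (Factorisation.length-split fac) ≤-refl

  module _ {w' w'' : List ℕ} (fac : Factorisation n w' w'') (1≤ : 1 ≤ length w') where
    open Factorisation fac

    piece-w'-↭ : piece f true w' ↭ w'
    piece-w'-↭ = piece-↭ unique-w' andre-w' (proj₁ (small-split fac 1≤)) true

    piece-w'-up : Up (piece f true w')
    piece-w'-up = piece-alternating unique-w' andre-w' (proj₁ (small-split fac 1≤)) true

    piece-1w''-↭ : ∀ t → piece f t (1 ∷ w'') ↭ 1 ∷ w''
    piece-1w''-↭ = piece-↭ unique-1w'' andre-1w'' (proj₂ (small-split fac 1≤))

    piece-1w''-alternating : ∀ t → Alternating t (piece f t (1 ∷ w''))
    piece-1w''-alternating = piece-alternating unique-1w'' andre-1w'' (proj₂ (small-split fac 1≤))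

    -- η(ρ(1w″)) starts with 1, so its complement starts with |1w″|, the rank of n.
    piece-1w''-head : ∀ t → ∃[ B ] (piece f t (1 ∷ w'') ≡ extreme t n ∷ B)
    piece-1w''-head t = head-of t (F-just⇒∷ (ηf f (ρ Y)) (ηρ-head unique-1w'' andre-1w'' small))
      where
      Y = 1 ∷ w''
      small = proj₂ (small-split fac 1≤)
      head-of : ∀ t → ∃[ E ] (ηf f (ρ Y) ≡ rank Y 1 ∷ E) → ∃[ B ] (piece f t Y ≡ extreme t n ∷ B)
      head-of true (E , ηρY≡) = map (unrank Y) E ,
        trans (cong (ρinv Y) ηρY≡) (cong (_∷ map (unrank Y) E) (unrank-rank Y (here refl)))
      head-of false (E , ηρY≡) = ρinv Y (map (suc (suc (length E)) ∸_) E) ,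
        trans (cong (ρinv Y ∘ comp) ηρY≡) (cong (_∷ ρinv Y (map (suc (suc (length E)) ∸_) E)) (begin
          unrank Y (suc (suc (length E)) ∸ rank Y 1) ≡⟨ cong (λ r → unrank Y (suc (suc (length E)) ∸ r)) rank-1 ⟩
          unrank Y (suc (length E))                  ≡⟨ cong (unrank Y) (trans length-E (sym rank-n)) ⟩
          unrank Y (rank Y n)                        ≡⟨ unrank-rank Y (there n∈w'') ⟩
          n                                          ∎))
        where
        open ≡-Reasoning
        rank-1 : rank Y 1 ≡ 1
        rank-1 = trans (rank-∷-≤ {1} w'' ≤-refl) (cong suc (rank-of-strictLowerBound w'' (All.tabulate 1<w'')))
        length-E : suc (length E) ≡ length Y
        length-E = trans (cong length (sym ηρY≡)) (IsPerm-length (ηρ-isPerm unique-1w'' andre-1w'' small))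
        rank-n : rank Y n ≡ length Y
        rank-n = rank-of-upperBound Y (All.tabulate (λ x∈ → proj₂ (inRange (∈-++⁺ʳ w' x∈))))

  module _ {w'' : List ℕ} (fac : Factorisation n [] w'') where
    open Factorisation fac

    piece-w''-↭ : piece f false w'' ↭ w''
    piece-w''-↭ = piece-↭ (Unique-++⁻ʳ (1 ∷ []) unique) andre-w'' (small-w'' fac) false

    1∷piece-w''-up : Up (1 ∷ piece f false w'')
    1∷piece-w''-up = Up-∷ (piece-alternating (Unique-++⁻ʳ (1 ∷ []) unique) andre-w'' (small-w'' fac) false)
      (All.tabulate (1<w'' ∘ ∈-resp-↭ piece-w''-↭))

  ηPrefix-↭ : ∀ {w' w''} → Factorisation n w' w'' → ηPrefix f w' ↭ w'
  ηPrefix-↭ {[]}    fac = ↭-refl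
  ηPrefix-↭ {_ ∷ _} fac = piece-w'-↭ fac (s≤s z≤n)

  ηPrefix-up : ∀ {w' w''} → Factorisation n w' w'' → Up (ηPrefix f w')
  ηPrefix-up {[]}    fac = _
  ηPrefix-up {_ ∷ _} fac = piece-w'-up fac (s≤s z≤n)

  ηSuffix-↭ : ∀ {w' w''} → Factorisation n w' w'' → ηSuffix f w' w'' ↭ 1 ∷ w''
  ηSuffix-↭ {[]}    fac = prep 1 (piece-w''-↭ fac)
  ηSuffix-↭ {w'@(_ ∷ _)} fac = piece-1w''-↭ fac (s≤s z≤n) (isEven (length w'))

  ηSuffix-alternating : ∀ {w' w''} → Factorisation n w' w'' →
    Alternating (isEven (length w')) (ηSuffix f w' w'')
  ηSuffix-alternating {[]}    fac = 1∷piece-w''-up fac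
  ηSuffix-alternating {w'@(_ ∷ _)} fac = piece-1w''-alternating fac (s≤s z≤n) (isEven (length w'))

  ηSuffix-head : ∀ {w' w''} → Factorisation n w' w'' →
    ∃[ B ] (ηSuffix f w' w'' ≡ extreme (isEven (length w')) n ∷ B)
  ηSuffix-head {[]}    fac = _ , refl
  ηSuffix-head {w'@(_ ∷ _)} fac = piece-1w''-head fac (s≤s z≤n) (isEven (length w'))

  ηStep-isPerm : ∀ {w' w''} → Factorisation n w' w'' → IsPerm n (ηStep f w' w'')
  ηStep-isPerm fac = ↭-trans (++⁺ (ηPrefix-↭ fac) (ηSuffix-↭ fac)) (Factorisation.isPerm fac)

  ηPrefix-phase : ∀ {w' w''} → Factorisation n w' w'' → phaseAfter (ηPrefix f w') true ≡ isEven (length w')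
  ηPrefix-phase {w'} fac = trans (phaseAfter-true (ηPrefix f w')) (cong isEven (↭-length (ηPrefix-↭ fac)))

  ηStep-up : ∀ {w' w''} → Factorisation n w' w'' → Up (ηStep f w' w'')
  ηStep-up {w'} {w''} fac with ηSuffix-head fac
  ... | B , S≡ = subst (Up ∘ (P ++_)) (sym S≡) (Alternating-++⁺ true P (extreme t n) B (ηPrefix-up fac)
        (subst (λ b → Junction b (extreme t n) P) (sym (ηPrefix-phase fac)) (extreme-junction t
          (All.tabulate (1<w' ∘ ∈-resp-↭ (ηPrefix-↭ fac))) (All.tabulate (w'<n ∘ ∈-resp-↭ (ηPrefix-↭ fac)))))
        (subst₂ Alternating (sym (ηPrefix-phase fac)) S≡ (ηSuffix-alternating fac)))
    where
    open Factorisation fac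
    P = ηPrefix f w'
    t = isEven (length w')

  ηStep-head : ∀ {w' w''} → Factorisation n w' w'' → F (w' ++ 1 ∷ w'') ≡ F (ηStep f w' w'')
  ηStep-head {[]}        fac = refl
  ηStep-head {w'@(x ∷ v)} {w''} fac with piece-head-true unique-w' andre-w' (proj₁ (small-split fac (s≤s z≤n)))
    where open Factorisation fac
  ... | B , P≡ = cong (F ∘ (_++ ηSuffix f w' w'')) (sym P≡)

  ηPrefix-avoids : ∀ {w' w''} → Factorisation n w' w'' → All (¬_ ∘ Extreme n) (ηPrefix f w')
  ηPrefix-avoids fac = All.tabulate λ x∈ → let x∈w' = ∈-resp-↭ (ηPrefix-↭ fac) x∈ in
    λ { (inj₁ refl) → <-irrefl refl (1<w' x∈w') ; (inj₂ refl) → <-irrefl refl (w'<n x∈w') }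
    where open Factorisation fac

  ηPrefix-injective : ∀ {w₁' w₁'' w₂' w₂''} → Factorisation n w₁' w₁'' → Factorisation n w₂' w₂'' →
    ηPrefix f w₁' ≡ ηPrefix f w₂' → w₁' ≡ w₂'
  ηPrefix-injective {[]}    {w₂' = []}    _    _    _  = refl
  ηPrefix-injective {_ ∷ _} {w₂' = []}    fac₁ _    eq with () ← ↭-length (subst (_↭ _) eq (ηPrefix-↭ fac₁))
  ηPrefix-injective {[]}    {w₂' = _ ∷ _} _    fac₂ eq with () ← ↭-length (subst (_↭ _) (sym eq) (ηPrefix-↭ fac₂))
  ηPrefix-injective {_ ∷ _} {w₂' = _ ∷ _} fac₁ fac₂ eq =
    piece-injective true (unique-w' fac₁) w₁'↭w₂' (andre-w' fac₁) (andre-w' fac₂)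
      (proj₁ (small-split fac₁ (s≤s z≤n))) eq
    where
    open Factorisation
    w₁'↭w₂' = ↭-trans (↭-sym (ηPrefix-↭ fac₁)) (subst (_↭ _) (sym eq) (ηPrefix-↭ fac₂))

  ηSuffix-injective : ∀ {w' w₁'' w₂''} → Factorisation n w' w₁'' → Factorisation n w' w₂'' →
    ηSuffix f w' w₁'' ≡ ηSuffix f w' w₂'' → w₁'' ≡ w₂''
  ηSuffix-injective {[]} {w₁''} {w₂''} fac₁ fac₂ eq =
    piece-injective false (Unique-++⁻ʳ (1 ∷ []) (unique fac₁)) (drop-∷ 1w₁''↭1w₂'') (andre-w'' fac₁) (andre-w'' fac₂)
      (small-w'' fac₁) (∷-injectiveʳ eq)
    where
    open Factorisation
    1w₁''↭1w₂'' : 1 ∷ w₁'' ↭ 1 ∷ w₂''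
    1w₁''↭1w₂'' = ↭-trans (↭-sym (ηSuffix-↭ fac₁)) (subst (_↭ 1 ∷ w₂'') (sym eq) (ηSuffix-↭ fac₂))
  ηSuffix-injective {w'@(_ ∷ _)} {w₁''} {w₂''} fac₁ fac₂ eq = ∷-injectiveʳ
    (piece-injective (isEven (length w')) (unique-1w'' fac₁) 1w₁''↭1w₂'' (andre-1w'' fac₁) (andre-1w'' fac₂)
      (proj₂ (small-split fac₁ (s≤s z≤n))) eq)
    where
    open Factorisation
    1w₁''↭1w₂'' : 1 ∷ w₁'' ↭ 1 ∷ w₂''
    1w₁''↭1w₂'' = ↭-trans (↭-sym (ηSuffix-↭ fac₁)) (subst (_↭ 1 ∷ w₂'') (sym eq) (ηSuffix-↭ fac₂))

  ηStep-cut : ∀ {w' w''} → Factorisation n w' w'' →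
    ∃[ B ] (ηStep f w' w'' ≡ ηPrefix f w' ++ extreme (isEven (length w')) n ∷ B)
  ηStep-cut {w'} fac = let B , S≡ = ηSuffix-head fac in B , cong (ηPrefix f w' ++_) S≡

  -- The first letter of η(w) in {1, n} comes right after the image of w′.
  ηStep-determines-prefix : ∀ {w₁' w₁'' w₂' w₂''} → Factorisation n w₁' w₁'' → Factorisation n w₂' w₂'' →
    ηStep f w₁' w₁'' ≡ ηStep f w₂' w₂'' → ηPrefix f w₁' ≡ ηPrefix f w₂'
  ηStep-determines-prefix {w₁'} {w₂' = w₂'} fac₁ fac₂ eq =
    let B₁ , eq₁ = ηStep-cut fac₁
        B₂ , eq₂ = ηStep-cut fac₂
    in prefix-before-first-≡ (ηPrefix f w₁') (ηPrefix f w₂') (ηPrefix-avoids fac₁) (ηPrefix-avoids fac₂)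
         (Extreme-extreme _) (Extreme-extreme _) (trans (sym eq₁) (trans eq eq₂))

  ηStep-injective : ∀ {w₁' w₁'' w₂' w₂''} → Factorisation n w₁' w₁'' → Factorisation n w₂' w₂'' →
    ηStep f w₁' w₁'' ≡ ηStep f w₂' w₂'' → w₁' ≡ w₂' × w₁'' ≡ w₂''
  ηStep-injective {w₁'} fac₁ fac₂ eq with refl ← ηPrefix-injective fac₁ fac₂ (ηStep-determines-prefix fac₁ fac₂ eq) =
    refl , ηSuffix-injective fac₁ fac₂ (++-cancelˡ (ηPrefix f w₁') _ _ eq)

  ηStep-surjective-[] : ∀ {B} → 2 ≤ n → IsPerm n (1 ∷ B) → Down B →
    ∃[ w'' ] (Factorisation n [] w'' × ηStep f [] w'' ≡ 1 ∷ B)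
  ηStep-surjective-[] {B} 2≤n p downB =
    let Z , Z↭B , aZ , piece≡B , _ = piece-surjective false uB downB smallB
        1Z-perm = ↭-trans (prep 1 Z↭B) p
        n∈Z = Any.tail (λ n≡1 → <⇒≱ 2≤n (≤-reflexive n≡1)) (IsPerm-∋ 1Z-perm (≤-trans (s≤s z≤n) 2≤n , ≤-refl))
    in Z , record { isPerm = 1Z-perm ; andre-w' = andre-e ; andre-w'' = aZ ; n∈w'' = n∈Z } , cong (1 ∷_) piece≡B
    where
    uB : Unique B
    uB = Unique-++⁻ʳ (1 ∷ []) (IsPerm-unique p)
    length-B : suc (length B) ≡ n
    length-B = IsPerm-length p
    smallB : Small n B
    smallB = ≤-pred (subst (2 ≤_) (sym length-B) 2≤n) , subst (length B <_) length-B ≤-refl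

  pieces-factorise : ∀ {A S Z₁ Z₂} → 2 ≤ n → IsPerm n (A ++ S) → All (¬_ ∘ Extreme n) A →
    Z₁ ↭ A → AndreI Z₁ → Z₂ ↭ S → AndreI Z₂ → F (ρ Z₂) ≡ just 1 →
    ∃[ w'' ] (Z₂ ≡ 1 ∷ w'' × Factorisation n Z₁ w'')
  pieces-factorise {A} {S} {Z₁} {Z₂} 2≤n p A-avoids Z₁↭A aZ₁ Z₂↭S aZ₂ hd =
    let w'' , Z₂≡ = starts-with-1 uZ₂ (∈Z₂ (inj₁ refl)) (All.tabulate (proj₁ ∘ inRangeZ₂)) hd
    in w'' , Z₂≡ , factorisation w'' Z₂≡
    where
    uZ₂ : Unique Z₂
    uZ₂ = Unique-resp-↭ (↭-sym Z₂↭S) (Unique-++⁻ʳ A (IsPerm-unique p))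
    inRangeZ₂ : ∀ {x} → x ∈ Z₂ → InRange n x
    inRangeZ₂ = IsPerm-inRange p ∘ ∈-++⁺ʳ A ∘ ∈-resp-↭ Z₂↭S
    ∈Z₂ : ∀ {x} → Extreme n x → x ∈ Z₂
    ∈Z₂ x-ext with ∈-++⁻ A (IsPerm-∋ p (extreme-inRange 2≤n x-ext))
    ... | inj₁ x∈A = ⊥-elim (All.lookup A-avoids x∈A x-ext)
    ... | inj₂ x∈S = ∈-resp-↭ (↭-sym Z₂↭S) x∈S
    factorisation : ∀ w'' → Z₂ ≡ 1 ∷ w'' → Factorisation n Z₁ w''
    factorisation w'' refl = record
      { isPerm    = ↭-trans (++⁺ Z₁↭A Z₂↭S) p
      ; andre-w'  = aZ₁
      ; andre-w'' = AndreI-∷⁻ (Unique-∷-least uZ₂ (proj₁ ∘ inRangeZ₂ ∘ there)) aZ₂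
      ; n∈w''     = Any.tail (λ n≡1 → <⇒≱ 2≤n (≤-reflexive n≡1)) (∈Z₂ (inj₂ refl))
      }

  ηStep-surjective-prefix : ∀ {A c B} → 2 ≤ n → 1 ≤ length A → IsPerm n (A ++ c ∷ B) → Up (A ++ c ∷ B) →
    All (¬_ ∘ Extreme n) A → Extreme n c →
    ∃[ w' ] ∃[ w'' ] (Factorisation n w' w'' × ηStep f w' w'' ≡ A ++ c ∷ B)
  ηStep-surjective-prefix {A} {c} {B} 2≤n 1≤A p up A-avoids c-ext with Up-++-extreme A 1≤A p up c-ext
  ... | upA , altS , refl =
    let Z₁ , Z₁↭A , aZ₁ , piece₁≡ , _  = piece-surjective true uA upA smallA
        Z₂ , Z₂↭S , aZ₂ , piece₂≡ , hd = piece-surjective t uS altS smallS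
        w'' , Z₂≡ , fac = pieces-factorise 2≤n p A-avoids Z₁↭A aZ₁ Z₂↭S aZ₂
                            (trans hd (compUnless-ρ-head t uS (All.tabulate (IsPerm-inRange p ∘ ∈-++⁺ʳ A ∘ there))))
    in Z₁ , w'' , fac , assemble Z₁↭A piece₁≡ (subst (λ Z → piece f t Z ≡ S) Z₂≡ piece₂≡)
    where
    t = isEven (length A)
    S = extreme t n ∷ B
    uA = Unique-++⁻ˡ A (IsPerm-unique p)
    uS = Unique-++⁻ʳ A (IsPerm-unique p)
    small = small-++ A S (trans (sym (length-++ A)) (IsPerm-length p)) 1≤A (s≤s z≤n)
    smallA = proj₁ small
    smallS = proj₂ small
    assemble : ∀ {Z₁ w''} → Z₁ ↭ A → piece f true Z₁ ≡ A → piece f t (1 ∷ w'') ≡ S → ηStep f Z₁ w'' ≡ A ++ S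
    assemble {Z₁} {w''} Z₁↭A piece₁≡ piece₂≡ = begin
      ηStep f Z₁ w''                                            ≡⟨ ηStep-nonempty f w'' (subst (1 ≤_) (sym |Z₁|≡|A|) 1≤A) ⟩
      piece f true Z₁ ++ piece f (isEven (length Z₁)) (1 ∷ w'') ≡⟨ cong (λ l → piece f true Z₁ ++ piece f (isEven l) (1 ∷ w'')) |Z₁|≡|A| ⟩
      piece f true Z₁ ++ piece f t (1 ∷ w'')                    ≡⟨ cong₂ _++_ piece₁≡ piece₂≡ ⟩
      A ++ S                                                    ∎
      where
      open ≡-Reasoning
      |Z₁|≡|A| = ↭-length Z₁↭A

  ηStep-surjective : ∀ {u} → 2 ≤ n → Alt n u →
    ∃[ w' ] ∃[ w'' ] (Factorisation n w' w'' × ηStep f w' w'' ≡ u)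
  ηStep-surjective {u} 2≤n (p , up)
    with first-occurrence (extreme? n) u (IsPerm-∋ p (extreme-inRange 2≤n (inj₁ refl))) (inj₁ refl)
  ... | [] , _ , B , refl , _ , inj₁ refl =
    let w'' , fac , eq = ηStep-surjective-[] 2≤n p (Up-∷⁻ up) in [] , w'' , fac , eq
  ... | [] , _ , B , refl , _ , inj₂ refl = ⊥-elim (max-cannot-start 2≤n p up)
  ... | A@(_ ∷ _) , _ , B , refl , A-avoids , c-ext = ηStep-surjective-prefix 2≤n (s≤s z≤n) p up A-avoids c-ext

  correct-step : 2 ≤ n → Correct n (suc f)
  correct-step 2≤n = record
    { alternating    = alternating ∘ factorise 2≤n
    ; head-preserved = head-preserved ∘ factorise 2≤n
    ; injective      = λ aw₁ aw₂ → injective (factorise 2≤n aw₁) (factorise 2≤n aw₂)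
    ; surjective     = λ alt → let w' , w'' , fac , eq = ηStep-surjective 2≤n alt in
        w' ++ 1 ∷ w'' , unfactorise fac , trans (unfold fac) eq
    }
    where
    unfold : ∀ {w' w''} → Factorisation n w' w'' → ηf (suc f) (w' ++ 1 ∷ w'') ≡ ηStep f w' w''
    unfold {w'} {w''} fac = ηf-suc f w' w'' 1∉w' (λ { refl → ¬Any[] n∈w'' })
      where open Factorisation fac
    alternating : ∀ {w} → Factorised n w → Alt n (ηf (suc f) w)
    alternating (factorised fac) = subst (Alt n) (sym (unfold fac)) (ηStep-isPerm fac , ηStep-up fac)
    head-preserved : ∀ {w} → Factorised n w → F w ≡ F (ηf (suc f) w)
    head-preserved (factorised fac) = trans (ηStep-head fac) (cong F (sym (unfold fac)))
    injective : ∀ {w₁ w₂} → Factorised n w₁ → Factorised n w₂ → ηf (suc f) w₁ ≡ ηf (suc f) w₂ → w₁ ≡ w₂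
    injective (factorised fac₁) (factorised fac₂) eq
      with refl , refl ← ηStep-injective fac₁ fac₂ (trans (sym (unfold fac₁)) (trans eq (unfold fac₂))) = refl

correct-1 : ∀ f → Correct 1 f
correct-1 f = record
  { alternating    = alternating
  ; head-preserved = head-preserved
  ; injective      = λ aw₁ aw₂ _ → trans (singleton aw₁) (sym (singleton aw₂))
  ; surjective     = λ { (p , _) → 1 ∷ [] , (↭-refl , andre-one 1) , trans (ηf-1 f) (sym (↭-singleton-inv p)) }
  }
  where
  singleton : ∀ {w} → AndI 1 w → w ≡ 1 ∷ []
  singleton (p , _) = ↭-singleton-inv p
  alternating : ∀ {w} → AndI 1 w → Alt 1 (ηf f w)
  alternating aw rewrite singleton aw | ηf-1 f = ↭-refl , _
  head-preserved : ∀ {w} → AndI 1 w → F w ≡ F (ηf f w)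
  head-preserved aw rewrite singleton aw | ηf-1 f = refl

correct : ∀ n → 1 ≤ n → ∀ {f} → n ≤ f → Correct n f
correct = <-rec (λ n → 1 ≤ n → ∀ {f} → n ≤ f → Correct n f) step
  where
  step : ∀ n → CorrectBelow n → 1 ≤ n → ∀ {f} → n ≤ f → Correct n f
  step 1             _  _ {f}     _   = correct-1 f
  step (suc (suc k)) ih _ {suc f} n≤f = InductiveStep.correct-step ih n≤f (s≤s (s≤s z≤n))

theorem2p2 : (n : ℕ) → 1 ≤ n →
    ((w : List ℕ) → AndI n w → Alt n (η w))
    × ((w₁ w₂ : List ℕ) → AndI n w₁ → AndI n w₂ → η w₁ ≡ η w₂ → w₁ ≡ w₂)
    × ((u : List ℕ) → Alt n u → ∃[ w ] (AndI n w × η w ≡ u))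
    × ((w : List ℕ) → AndI n w → F w ≡ F (η w))
theorem2p2 n 1≤n =
    (λ w aw → subst (Alt n) (ηf-n aw) (alternating aw))
  , (λ w₁ w₂ aw₁ aw₂ eq → injective aw₁ aw₂ (trans (ηf-n aw₁) (trans eq (sym (ηf-n aw₂)))))
  , (λ u alt → let w , aw , eq = surjective alt in w , aw , trans (sym (ηf-n aw)) eq)
  , (λ w aw → trans (head-preserved aw) (cong F (ηf-n aw)))
  where
  open Correct (correct n 1≤n ≤-refl)
  ηf-n : ∀ {w} → AndI n w → ηf n w ≡ η w
  ηf-n {w} (p , _) = cong (λ l → ηf l w) (sym (IsPerm-length p))
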